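{- Let $U$ be a based scheme on $Y$ and $S$ a based scheme on $Z$. Let $\tilde T\subseteq S$ be a closed subset, and let $i:U\to S$ be a based morphism of schemes such that $i\pi:U\to S/\!\!/\tilde T$ is an isomorphism, where $\pi:S\to S/\!\!/\tilde T$ is the natural morphism. Assume $|t(ui)|=1$ for every $u\in U$ and $t\in\tilde T$. For $u\in U$ let $\tilde T'_u=\{t\in\tilde T:t(ui)=\{ui\}\}$. Then $\tilde T'_u$ is normal in $\tilde T$, i.e. $\tilde T'_u\,t=t\,\tilde T'_u$ for every $t\in\tilde T$.
   Context: All schemes are association schemes on finite sets. For $p,q\in S$, $pq=\{r\in S:a_{pqr}>0\}$ (complex product), extended to subsets by unions. $\tilde T$ closed means $\tilde T^*\tilde T\subseteq\tilde T$. For closed $\tilde T$: cosets $z\tilde T=\bigcup_{t\in\tilde T}zt$, $zt=\{z':(z,z')\in t\}$; $s^{\tilde T}=\{(z_1\tilde T,z_2\tilde T):(z_1',z_2')\in s$ for some $z_i'\in z_i\tilde T\}$; $S/\!\!/\tilde T=\{s^{\tilde T}\}$. A morphism of schemes $i$ from $U$ on $Y$ to $S$ on $Z$ is a map $Y\to Z$ sending pairs in a common element of $U$ to pairs in a common element of $S$; $ui$ denotes the element of $S$ containing the images of pairs in $u$. An isomorphism is bijective on points and relations. Based morphisms preserve basepoints; quotients are based at the coset of the basepoint. -}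

module Defs where

open import Data.Nat using (ℕ)
open import Data.Fin using (Fin; _≟_)
open import Data.List using (length; filter)
open import Data.List.Base using () renaming (allFin to allFinL)
open import Data.Product using (Σ; ∃; ∃-syntax; _×_; _,_)
open import Data.Product.Properties using ()
open import Relation.Nullary.Decidable using (_×-dec_)
open import Relation.Binary.PropositionalEquality using (_≡_)
open import Function.Bundles using (_⇔_)

-- A (finite) scheme: points Fin n, relations (elements of S) Fin d;
-- the partition of Z × Z is given by a colouring  rel : Fin n → Fin n → Fin d,
-- element s of S being the relation {(x , y) : rel x y ≡ s}.

count₃ : ∀ {n d} → (Fin n → Fin n → Fin d) → Fin d → Fin d → Fin n → Fin n → ℕ
count₃ {n} rel p q x y =
  length (filter (λ z → (rel x z ≟ p) ×-dec (rel z y ≟ q)) (allFinL n))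

IsTranspose : ∀ {n d} → (Fin n → Fin n → Fin d) → Fin d → Fin d → Set
IsTranspose rel s s' = ∀ x y → (rel x y ≡ s) ⇔ (rel y x ≡ s')

record IsScheme {n d : ℕ} (rel : Fin n → Fin n → Fin d) : Set where
  field
    nonempty  : ∀ s → ∃[ x ] ∃[ y ] rel x y ≡ s
    diagonal  : ∃[ e ] ((∀ x → rel x x ≡ e) × (∀ x y → rel x y ≡ e → x ≡ y))
    transpose : ∀ s → ∃[ s' ] IsTranspose rel s s'
    intersection : ∀ p q r → ∃[ a ] (∀ x y → rel x y ≡ r → count₃ rel p q x y ≡ a)

record BasedScheme : Set where
  field
    n d  : ℕ
    rel  : Fin n → Fin n → Fin d
    isScheme : IsScheme rel
    base : Fin n
open BasedScheme public

module _ (S : BasedScheme) where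

  Elt : Set
  Elt = Fin (d S)

  Pt : Set
  Pt = Fin (n S)

  SubsetS : Set₁
  SubsetS = Elt → Set

  -- complex product:  r ∈ p q  iff  a_{pqr} > 0, i.e. some (x,y) ∈ r has a
  -- z with (x,z) ∈ p and (z,y) ∈ q  (a_{pqr} does not depend on (x,y) ∈ r)
  _∈_·_ : Elt → Elt → Elt → Set
  r ∈ p · q = ∃[ x ] ∃[ y ] ∃[ z ] (rel S x y ≡ r × rel S x z ≡ p × rel S z y ≡ q)

  _∈⟨_⟩·_ : Elt → SubsetS → Elt → Set
  r ∈⟨ A ⟩· t = ∃[ a ] (A a × r ∈ a · t)

  _∈_·⟨_⟩ : Elt → Elt → SubsetS → Set
  r ∈ t ·⟨ A ⟩ = ∃[ a ] (A a × r ∈ t · a)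

  Closed : SubsetS → Set
  Closed T = ∀ t₁ t₂ t₁* r → T t₁ → T t₂ → IsTranspose (rel S) t₁ t₁* →
             r ∈ t₁* · t₂ → T r

  _∈Coset_ : Pt → Pt × SubsetS → Set
  z' ∈Coset (z , T) = ∃[ t ] (T t × rel S z z' ≡ t)

  SameCoset : SubsetS → Pt → Pt → Set
  SameCoset T z₁ z₂ = ∀ w → (w ∈Coset (z₁ , T)) ⇔ (w ∈Coset (z₂ , T))

  InQuot : SubsetS → Elt → Pt → Pt → Set
  InQuot T s z₁ z₂ =
    ∃[ z₁' ] ∃[ z₂' ] (z₁' ∈Coset (z₁ , T) × z₂' ∈Coset (z₂ , T) × rel S z₁' z₂' ≡ s)

  -- s^T̃ = s'^T̃  (equality of elements of S//T̃, as sets of pairs of cosets)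
  SameQuotElt : SubsetS → Elt → Elt → Set
  SameQuotElt T s s' = ∀ z₁ z₂ → InQuot T s z₁ z₂ ⇔ InQuot T s' z₁ z₂

-- A based morphism U → S: a point map i together with the induced map
-- u ↦ u i on elements (the element of S containing the images of u).
record BasedMorphism (U S : BasedScheme) : Set where
  field
    pt  : Pt U → Pt S
    elt : Elt U → Elt S
    resp  : ∀ y₁ y₂ → rel S (pt y₁) (pt y₂) ≡ elt (rel U y₁ y₂)
    based : pt (base U) ≡ base S
open BasedMorphism public

ImgIn : (U S : BasedScheme) → BasedMorphism U S → SubsetS S → Elt U → Elt S → Set
ImgIn U S i T u s = ∀ y₁ y₂ → rel U y₁ y₂ ≡ u → InQuot S T s (pt i y₁) (pt i y₂)

IsoToQuotient : (U S : BasedScheme) → BasedMorphism U S → SubsetS S → Set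
IsoToQuotient U S i T =
  (∀ y₁ y₂ → SameCoset S T (pt i y₁) (pt i y₂) → y₁ ≡ y₂) ×
  (∀ z → ∃[ y ] SameCoset S T (pt i y) z) ×
  (∀ u → ∃[ s ] ImgIn U S i T u s) ×
  (∀ u₁ u₂ s₁ s₂ → ImgIn U S i T u₁ s₁ → ImgIn U S i T u₂ s₂ →
     SameQuotElt S T s₁ s₂ → u₁ ≡ u₂) ×
  (∀ s → ∃[ u ] ∃[ s' ] (ImgIn U S i T u s' × SameQuotElt S T s' s))

-- Fix an image point x₀ = y₀ i.  If x₀ --a--> z --t--> y with a ∈ T̃'_u and t ∈ T̃,
-- pick an s-successor q of y (s = u i) and an image point x₃ in the coset of q.
-- The pairs (x₀, x₃) and (y, q) have T̃-related endpoints, so they define the same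
-- element of S//T̃; as iπ is injective on relations, (x₀, x₃) ∈ s.  Since s t is a
-- singleton for t ∈ T̃ and a fixes s, the points x₀ and z are in the same relation
-- to q, so the path z --t--> y --s--> q can be moved to x₀ --t--> w --s--> q, and
-- then (w, y) lies in T̃'_u.  This gives T̃'_u t ⊆ t T̃'_u; the reverse inclusion
-- follows by transposition.
module Submission where

open import Defs
open import Data.Product using (∃-syntax; _×_)
open import Relation.Binary.PropositionalEquality using (_≡_)
open import Function.Bundles using (_⇔_)

open import Data.Nat using (_<_)
open import Data.Fin using () renaming (_≟_ to _≟ᶠ_)
open import Data.List using (List; _∷_; length; filter)
open import Data.List.Base using () renaming (allFin to allFinL)
open import Data.List.Membership.Propositional using (_∈_)
open import Data.List.Membership.Propositional.Properties
  using (∈-filter⁺; ∈-filter⁻; ∈-allFin; ∈-length)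
open import Data.List.Relation.Unary.Any using (here)
open import Data.Product using (∃; _,_; proj₁; proj₂)
open import Relation.Nullary.Decidable using (_×-dec_)
open import Relation.Unary using (Decidable)
open import Relation.Binary.PropositionalEquality
  using (refl; sym; trans; cong; subst; subst₂)
open import Function.Bundles using (mk⇔; Equivalence)

∈-of-length : ∀ {A : Set} {xs : List A} → 0 < length xs → ∃ (_∈ xs)
∈-of-length {xs = x ∷ _} _ = x , here refl

module SchemeProperties (S : BasedScheme) where
  open IsScheme (isScheme S)

  private
    R : Pt S → Pt S → Elt S
    R = rel S

  -- The p-q paths from x to y are counted by a_{pqr}, which is the same for all (x, y) ∈ r.
  ∈·⇒path : ∀ {p q r x y} → _∈_·_ S r p q → R x y ≡ r →
            ∃[ z ] (R x z ≡ p × R z y ≡ q)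
  ∈·⇒path {p} {q} {r} {x} {y} (x₀ , y₀ , z₀ , x₀y₀≡r , x₀z₀≡p , z₀y₀≡q) xy≡r =
    let a , count≡a = intersection p q r
        count₀≡count = trans (count≡a x₀ y₀ x₀y₀≡r) (sym (count≡a x y xy≡r))
        z , z∈paths = ∈-of-length (subst (0 <_) count₀≡count (∈-length z₀∈paths₀))
    in z , proj₂ (∈-filter⁻ (path? x y) {xs = allFinL _} z∈paths)
    where
    path? : ∀ x y → Decidable (λ z → R x z ≡ p × R z y ≡ q)
    path? x y z = (R x z ≟ᶠ p) ×-dec (R z y ≟ᶠ q)
    z₀∈paths₀ : z₀ ∈ filter (path? x₀ y₀) (allFinL _)
    z₀∈paths₀ = ∈-filter⁺ (path? x₀ y₀) (∈-allFin z₀) (x₀z₀≡p , z₀y₀≡q)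

  rel-diagonal : ∀ x y → R x x ≡ R y y
  rel-diagonal x y = let _ , diag , _ = diagonal in trans (diag x) (sym (diag y))

  rel-swap : ∀ {x y x' y'} → R x y ≡ R x' y' → R y x ≡ R y' x'
  rel-swap {x} {y} {x'} {y'} xy≡x'y' =
    let _ , transposed = transpose (R x' y')
    in trans (Equivalence.to (transposed x y) xy≡x'y')
             (sym (Equivalence.to (transposed x' y') refl))

  swap-isTranspose : ∀ x y → IsTranspose R (R x y) (R y x)
  swap-isTranspose x y _ _ = mk⇔ rel-swap rel-swap

  successor : ∀ p x → ∃[ y ] R x y ≡ p
  successor p x =
    let a , b , ab≡p = nonempty p
        y , xy≡p , _ = ∈·⇒path (a , a , b , refl , ab≡p , refl) (rel-diagonal x a)
    in y , xy≡p

  ∈·-from : ∀ {p q r} → _∈_·_ S r p q → ∀ x →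
            ∃[ y ] ∃[ z ] (R x y ≡ r × R x z ≡ p × R z y ≡ q)
  ∈·-from r∈pq x =
    let y , xy≡r = successor _ x
        z , xz≡p , zy≡q = ∈·⇒path r∈pq xy≡r
    in y , z , xy≡r , xz≡p , zy≡q

  Swap-closed : SubsetS S → Set
  Swap-closed A = ∀ {x y} → A (R x y) → A (R y x)

  ·⟨⟩⊆⟨⟩·-by-swap : (A K : SubsetS S) → Swap-closed A → Swap-closed K →
    (∀ {t r} → A t → _∈⟨_⟩·_ S r K t → _∈_·⟨_⟩ S r t K) →
    ∀ {t r} → A t → _∈_·⟨_⟩ S r t K → _∈⟨_⟩·_ S r K t
  ·⟨⟩⊆⟨⟩·-by-swap A K A-swap K-swap ⟨⟩·⊆·⟨⟩ t∈A (b , b∈K , x , y , z , xy≡r , xz≡t , zy≡b) =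
    let c , c∈K , x' , y' , w , x'y'≡yx , x'w≡zx , wy'≡c =
          ⟨⟩·⊆·⟨⟩ (A-swap (subst A (sym xz≡t) t∈A))
                   (R y z , K-swap (subst K (sym zy≡b) b∈K) , y , x , z , refl , refl , refl)
    in R y' w , K-swap (subst K (sym wy'≡c) c∈K) ,
       y' , x' , w , trans (rel-swap x'y'≡yx) xy≡r , refl , trans (rel-swap x'w≡zx) xz≡t

  module ClosedSubset (T : SubsetS S) (closed : Closed S T) where

    T-sym : Swap-closed T
    T-sym {x} {y} xy∈T =
      closed (R x y) (R x x) (R y x) (R y x) xy∈T (subst T (rel-diagonal y x) yy∈T)
             (swap-isTranspose x y) (y , x , x , refl , refl , refl)
      where
      yy∈T : T (R y y)
      yy∈T = closed (R x y) (R x y) (R y x) (R y y) xy∈T xy∈T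
                    (swap-isTranspose x y) (y , y , x , refl , refl , refl)

    T-trans : ∀ {x y z} → T (R x y) → T (R y z) → T (R x z)
    T-trans {x} {y} {z} xy∈T yz∈T =
      closed (R y x) (R y z) (R x y) (R x z) (T-sym xy∈T) yz∈T
             (swap-isTranspose y x) (x , z , y , refl , refl , refl)

    T-refl : ∀ {t} → T t → ∀ z → T (R z z)
    T-refl t∈T z =
      let x , y , xy≡t = nonempty _
          xy∈T = subst T (sym xy≡t) t∈T
      in subst T (rel-diagonal x z) (T-trans xy∈T (T-sym xy∈T))

    InQuot-⊆ : ∀ {x x' y y'} → T (R x x') → T (R y y') →
               ∀ z₁ z₂ → InQuot S T (R x y) z₁ z₂ → InQuot S T (R x' y') z₁ z₂
    InQuot-⊆ {x} {x'} {y} {y'} xx'∈T yy'∈T z₁ z₂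
             (z₁' , z₂' , (_ , z₁z₁'∈T , z₁z₁'≡) , (_ , z₂z₂'∈T , z₂z₂'≡) , z₁'z₂'≡xy) =
      let w₁ , z₁'w₁≡xx' , w₁z₂'≡x'y = ∈·⇒path (x , y , x' , refl , refl , refl) z₁'z₂'≡xy
          w₂ , w₁w₂≡x'y' , w₂z₂'≡y'y = ∈·⇒path (x' , y , y' , refl , refl , refl) w₁z₂'≡x'y
      in w₁ , w₂ ,
         (R z₁ w₁ , T-trans (subst T (sym z₁z₁'≡) z₁z₁'∈T)
                            (subst T (sym z₁'w₁≡xx') xx'∈T) , refl) ,
         (R z₂ w₂ , T-trans (subst T (sym z₂z₂'≡) z₂z₂'∈T)
                            (T-sym (subst T (sym w₂z₂'≡y'y) (T-sym yy'∈T))) , refl) ,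
         w₁w₂≡x'y'

    SameQuotElt-of-T : ∀ {x x' y y'} → T (R x x') → T (R y y') →
                       SameQuotElt S T (R x y) (R x' y')
    SameQuotElt-of-T xx'∈T yy'∈T z₁ z₂ =
      mk⇔ (InQuot-⊆ xx'∈T yy'∈T z₁ z₂) (InQuot-⊆ (T-sym xx'∈T) (T-sym yy'∈T) z₁ z₂)

module MorphismProperties {U S : BasedScheme} (i : BasedMorphism U S) where

  elt-swap : ∀ v → ∃[ w ] (∀ {x y} → rel S x y ≡ elt i v → rel S y x ≡ elt i w)
  elt-swap v =
    let y₁ , y₂ , y₁y₂≡v = IsScheme.nonempty (isScheme U) v
        y₁y₂i≡vi = trans (resp i y₁ y₂) (cong (elt i) y₁y₂≡v)
    in rel U y₂ y₁ , λ xy≡vi →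
         trans (SchemeProperties.rel-swap S (trans xy≡vi (sym y₁y₂i≡vi))) (resp i y₂ y₁)

module QuotientIsomorphism
    (U S : BasedScheme) (T : SubsetS S) (closed : Closed S T)
    (i : BasedMorphism U S) (iso : IsoToQuotient U S i T)
    (T-reflexive : ∀ z → T (rel S z z)) where

  open SchemeProperties S
  open ClosedSubset T closed

  private
    R : Pt S → Pt S → Elt S
    R = rel S

  image-in : ∀ v → ImgIn U S i T v (elt i v)
  image-in v y₁ y₂ y₁y₂≡v =
    pt i y₁ , pt i y₂ , (_ , T-reflexive _ , refl) , (_ , T-reflexive _ , refl) ,
    trans (resp i y₁ y₂) (cong (elt i) y₁y₂≡v)

  elt-injective : ∀ {v₁ v₂} → SameQuotElt S T (elt i v₁) (elt i v₂) → v₁ ≡ v₂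
  elt-injective {v₁} {v₂} =
    let _ , _ , _ , injective , _ = iso
    in injective v₁ v₂ _ _ (image-in v₁) (image-in v₂)

  coset-representative : ∀ z → ∃[ y ] T (R (pt i y) z)
  coset-representative z =
    let _ , surjective , _ = iso
        y , sameCoset = surjective z
        _ , t∈T , yz≡t = Equivalence.from (sameCoset z) (R z z , T-reflexive z , refl)
    in y , subst T (sym yz≡t) t∈T

  image-rel-of-T : ∀ {y₁ y₂ x x' v} → T (R (pt i y₁) x) → T (R (pt i y₂) x') →
                   R x x' ≡ elt i v → R (pt i y₁) (pt i y₂) ≡ elt i v
  image-rel-of-T {y₁} {y₂} y₁x∈T y₂x'∈T xx'≡v =
    trans (resp i y₁ y₂)
      (cong (elt i) (elt-injective
        (subst₂ (SameQuotElt S T) (resp i y₁ y₂) xx'≡v (SameQuotElt-of-T y₁x∈T y₂x'∈T))))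

module Normality
    (U S : BasedScheme) (T : SubsetS S) (closed : Closed S T)
    (i : BasedMorphism U S) (iso : IsoToQuotient U S i T)
    (T-reflexive : ∀ z → T (rel S z z))
    (T·-singleton : ∀ u t → T t →
      ∃[ r ] ((_∈_·_ S r t (elt i u)) × (∀ r' → _∈_·_ S r' t (elt i u) → r' ≡ r)))
    (u : Elt U) where

  open SchemeProperties S
  open ClosedSubset T closed
  open MorphismProperties i
  open QuotientIsomorphism U S T closed i iso T-reflexive

  private
    R : Pt S → Pt S → Elt S
    R = rel S
    s : Elt S
    s = elt i u

  Stab : SubsetS S
  Stab t = T t × (∀ r → (_∈_·_ S r t (elt i u)) ⇔ (r ≡ elt i u))

  T·elt-unique : ∀ {t r₁ r₂ v} → T t →
                 _∈_·_ S r₁ t (elt i v) → _∈_·_ S r₂ t (elt i v) → r₁ ≡ r₂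
  T·elt-unique {t} {r₁} {r₂} {v} t∈T r₁∈ r₂∈ =
    let _ , _ , unique = T·-singleton v t t∈T
    in trans (unique r₁ r₁∈) (sym (unique r₂ r₂∈))

  -- v i T̃ is a singleton too, being the transpose of T̃ (v i)* where (v i)* = (v*) i.
  elt·T-unique : ∀ {t r₁ r₂ v} → T t →
                 _∈_·_ S r₁ (elt i v) t → _∈_·_ S r₂ (elt i v) t → r₁ ≡ r₂
  elt·T-unique {v = v} t∈T (x₁ , y₁ , z₁ , x₁y₁≡r₁ , x₁z₁≡v , z₁y₁≡t)
                           (x₂ , y₂ , z₂ , x₂y₂≡r₂ , x₂z₂≡v , z₂y₂≡t) =
    let _ , swap-v = elt-swap v
        y₁x₁≡y₂x₂ = T·elt-unique (T-sym (subst T (sym z₁y₁≡t) t∈T))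
                      (y₁ , x₁ , z₁ , refl , refl , swap-v x₁z₁≡v)
                      (y₂ , x₂ , z₂ , refl , rel-swap (trans z₂y₂≡t (sym z₁y₁≡t)) , swap-v x₂z₂≡v)
    in trans (sym x₁y₁≡r₁) (trans (rel-swap y₁x₁≡y₂x₂) x₂y₂≡r₂)

  Stab-successor : ∀ {b x z q} → Stab b → R x z ≡ b → R x q ≡ s → R z q ≡ s
  Stab-successor (b∈T , fixes) xz≡b xq≡s =
    let x₁ , q₁ , z₁ , x₁q₁≡s , x₁z₁≡b , z₁q₁≡s = Equivalence.from (fixes s) refl
    in trans (T·elt-unique (T-sym (subst T (sym xz≡b) b∈T))
                (_ , _ , _ , refl , refl , xq≡s)
                (_ , _ , _ , refl , rel-swap (trans x₁z₁≡b (sym xz≡b)) , x₁q₁≡s))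
             z₁q₁≡s

  Stab-intro : ∀ {w y q} → T (R w y) → R y q ≡ s → R w q ≡ s → Stab (R w y)
  Stab-intro {w} {y} {q} wy∈T yq≡s wq≡s = wy∈T , λ r → mk⇔
    (λ r∈wy·s → trans (T·elt-unique wy∈T r∈wy·s (w , q , y , refl , refl , yq≡s)) wq≡s)
    (λ r≡s → w , q , y , trans wq≡s (sym r≡s) , refl , yq≡s)

  Stab-swap : Swap-closed Stab
  Stab-swap {x} xy∈Stab =
    let q , xq≡s = successor s x
    in Stab-intro (T-sym (proj₁ xy∈Stab)) xq≡s (Stab-successor xy∈Stab refl xq≡s)

  image-Stab-shift : ∀ {y₀ z y q a} → Stab a → R (pt i y₀) z ≡ a → T (R z y) →
                     R y q ≡ s → R (pt i y₀) q ≡ R z q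
  image-Stab-shift {y₀} {q = q} a∈Stab@(a∈T , _) x₀z≡a zy∈T yq≡s =
    let y₃ , x₃q∈T = coset-representative q
        x₀y∈T = T-trans (subst T (sym x₀z≡a) a∈T) zy∈T
        x₀x₃≡s = image-rel-of-T {y₀} {y₃} x₀y∈T x₃q∈T yq≡s
        zx₃≡s = Stab-successor a∈Stab x₀z≡a x₀x₃≡s
    in elt·T-unique x₃q∈T (_ , _ , _ , refl , x₀x₃≡s , refl) (_ , _ , _ , refl , zx₃≡s , refl)

  Stab·⊆·Stab : ∀ {t r} → T t → _∈⟨_⟩·_ S r Stab t → _∈_·⟨_⟩ S r t Stab
  Stab·⊆·Stab t∈T (a , a∈Stab@(a∈T , _) , r∈a·t) =
    let x₀ = pt i (base U)
        y , z , x₀y≡r , x₀z≡a , zy≡t = ∈·-from r∈a·t x₀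
        zy∈T = subst T (sym zy≡t) t∈T
        q , yq≡s = successor s y
        w , x₀w≡t , wq≡s = ∈·⇒path (z , q , y , refl , zy≡t , yq≡s)
                                   (image-Stab-shift a∈Stab x₀z≡a zy∈T yq≡s)
        wy∈T = T-trans (T-sym (subst T (sym x₀w≡t) t∈T))
                       (T-trans (subst T (sym x₀z≡a) a∈T) zy∈T)
    in R w y , Stab-intro wy∈T yq≡s wq≡s , x₀ , y , w , x₀y≡r , x₀w≡t , refl

corollary7p11 :
    (U S : BasedScheme) (T : SubsetS S) → Closed S T →
    (i : BasedMorphism U S) → IsoToQuotient U S i T →
    (∀ u t → T t →
      ∃[ r ] ((_∈_·_ S r t (elt i u)) × (∀ r' → _∈_·_ S r' t (elt i u) → r' ≡ r))) →
    ∀ u →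
      let T' : SubsetS S
          T' t = T t × (∀ r → (_∈_·_ S r t (elt i u)) ⇔ (r ≡ elt i u))
      in ∀ t → T t → ∀ r → (_∈⟨_⟩·_ S r T' t) ⇔ (_∈_·⟨_⟩ S r t T')
corollary7p11 U S T closed i iso T·-singleton u t t∈T r =
  mk⇔ (Stab·⊆·Stab t∈T)
      (·⟨⟩⊆⟨⟩·-by-swap T Stab T-sym Stab-swap Stab·⊆·Stab t∈T)
  where
  open SchemeProperties S
  open ClosedSubset T closed
  open Normality U S T closed i iso (T-refl t∈T) T·-singleton u
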